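{- $f_{\mathsf{AS}}$ maps $\mathsf{CAsc}_n$ bijectively to $\mathcal{S}_n(231)$.
   Context: $\mathsf{CAsc}_n$ is the set of $101$-avoiding ascent sequences of length $n$ (ascent sequence: non-negative integers, $a_1=0$, $a_i\le\mathsf{asc}(a_1,\ldots,a_{i-1})+1$ with $\mathsf{asc}$ the number of ascents; $101$-avoiding: no $i<j<k$ with $a_i=a_k>a_j$). $\mathcal{S}_n(231)$ is the set of 231-avoiding permutations of length $n$. $f_{\mathsf{AS}}$: start with the permutation $1$; a site between positions $i$ and $i+1$ of $\pi$ is active if $\pi_i=1$ or $\pi_i-1$ lies to the left of $\pi_i$, and the sites before the first and after the last position are always active; label the active sites $0,1,2,\ldots$ from left to right; for $k=2,\ldots,n$ insert $k$ at the active site labelled $a_k$. It is a bijection from ascent sequences of length $n$ to permutations avoiding the bivincular pattern $2|3\overline{1}$. -}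

module Defs where

open import Data.Nat using (ℕ; zero; suc; _+_; _∸_; _≤_; _<_; _>_; _≡ᵇ_)
open import Data.Bool using (Bool; true; false; _∨_; if_then_else_)
open import Data.List using (List; []; _∷_; length; take; drop; _++_; lookup; filterᵇ; upTo; map)
open import Data.Bool.ListAction using (any)
open import Data.List.Relation.Binary.Permutation.Propositional using (_↭_)
open import Data.Fin using (Fin; toℕ) renaming (_<_ to _<ᶠ_)
open import Data.Product using (∃; Σ; _×_; _,_)
open import Relation.Binary.PropositionalEquality using (_≡_)
open import Relation.Nullary using (¬_)

asc : List ℕ → ℕ
asc []           = 0
asc (x ∷ [])     = 0
asc (x ∷ y ∷ xs) = (if suc x Data.Nat.≤ᵇ y then 1 else 0) + asc (y ∷ xs)

IsAscentSeq : List ℕ → Set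
IsAscentSeq xs =
  (∀ (i : Fin (length xs)) → toℕ i ≡ 0 → lookup xs i ≡ 0) ×
  (∀ (i : Fin (length xs)) → lookup xs i ≤ asc (take (toℕ i) xs) + 1)

Avoids101 : List ℕ → Set
Avoids101 xs = ¬ (Σ (Fin (length xs)) λ i → Σ (Fin (length xs)) λ j → Σ (Fin (length xs)) λ k →
  i <ᶠ j × j <ᶠ k × lookup xs i ≡ lookup xs k × lookup xs j < lookup xs k)

CAsc : ℕ → List ℕ → Set
CAsc n xs = length xs ≡ n × IsAscentSeq xs × Avoids101 xs

-- 231-avoiding permutations of [n] = {1,…,n}, in one-line notation

IsPerm : ℕ → List ℕ → Set
IsPerm n π = π ↭ map suc (upTo n)

Avoids231 : List ℕ → Set
Avoids231 π = ¬ (Σ (Fin (length π)) λ i → Σ (Fin (length π)) λ j → Σ (Fin (length π)) λ k →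
  i <ᶠ j × j <ᶠ k × lookup π k < lookup π i × lookup π i < lookup π j)

S231 : ℕ → List ℕ → Set
S231 n π = IsPerm n π × Avoids231 π

nthOr : {A : Set} → A → ℕ → List A → A
nthOr d _       []       = d
nthOr d zero    (x ∷ xs) = x
nthOr d (suc i) (x ∷ xs) = nthOr d i xs

elemᵇ : ℕ → List ℕ → Bool
elemᵇ x ys = any (λ y → x ≡ᵇ y) ys

-- site p (0 ≤ p ≤ length π) is the gap just before (0-indexed) position p.
-- It is active if p = 0, p = length π, or (for the entry x = π at index p-1)
-- x = 1 or x - 1 occurs to the left of x.
isActive : List ℕ → ℕ → Bool
isActive π zero    = true
isActive π (suc i) =
  (suc i ≡ᵇ length π) ∨ (x ≡ᵇ 1) ∨ elemᵇ (x ∸ 1) (take i π)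
  where x = nthOr 0 i π

-- active sites in left-to-right order; the label of a site is its index here
activeSites : List ℕ → List ℕ
activeSites π = filterᵇ (isActive π) (upTo (suc (length π)))

insertAt : ℕ → ℕ → List ℕ → List ℕ
insertAt p k π = take p π ++ (k ∷ drop p π)

-- insert k into π at the active site labelled a
-- (out-of-range labels never occur for ascent sequences; default: the end)
step : ℕ → ℕ → List ℕ → List ℕ
step k a π = insertAt (nthOr (length π) a (activeSites π)) k π

fAS-go : ℕ → List ℕ → List ℕ → List ℕ
fAS-go k []       π = π
fAS-go k (a ∷ as) π = fAS-go (suc k) as (step k a π)

fAS : List ℕ → List ℕ
fAS []       = []
fAS (_ ∷ as) = fAS-go 2 as (1 ∷ [])

-- Both sides are built one step at a time: a 101-avoiding ascent sequence by appending an entry,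
-- f_AS(xs) by inserting a new maximum at an active site. In a 101-avoiding ascent sequence the
-- values are exactly 0, …, asc, and c may be appended iff c ≤ asc + 1 and no smaller entry follows
-- an occurrence of c. In a 231-avoiding permutation a new maximum may be inserted exactly at the
-- cuts, the sites with everything on the left below everything on the right, and cuts are active.
-- The key invariant is that the labels of the cuts of f_AS(xs) are exactly the entries allowed
-- after xs; inserting at the cut labelled b restores it for xs followed by b. Injectivity follows as
-- the position of the maximum recovers the cut and its label, and surjectivity by deleting the
-- maximum, which leaves a cut behind.
module Submission where

open import Defs
open import Data.Bool using (Bool; true; false; _∨_; T; if_then_else_)
open import Data.Bool.Properties using (∨-zeroʳ)
open import Data.Empty using (⊥; ⊥-elim)
open import Data.Fin using (Fin; toℕ) renaming (zero to fzero; suc to fsuc; _<_ to _<ᶠ_)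
open import Data.List using (List; []; _∷_; [_]; _++_; length; lookup; take; drop; upTo; map; filterᵇ)
open import Data.List.Properties
  using ( ++-identityʳ; ++-assoc; ∷-injective; ∷ʳ-injective; length-++; length-++-≤ˡ; length-take
        ; take-all; drop-all; take++drop≡id; upTo-∷ʳ; map-++; filter-++)
open import Data.List.Membership.Propositional using (_∈_; _∉_)
open import Data.List.Membership.Propositional.Properties
  using (∈-++⁻; ∈-++⁺ˡ; ∈-++⁺ʳ; ∈-map⁻; ∈-map⁺; ∈-upTo⁻; ∈-upTo⁺; ∈-∃++)
open import Data.List.Membership.Setoid.Properties using (∉[])
open import Data.List.Relation.Binary.Permutation.Propositional
  using (_↭_; ↭-refl; ↭-sym; ↭⇒↭ₛ; module PermutationReasoning)
open import Data.List.Relation.Binary.Permutation.Propositional.Properties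
  using (∈-resp-↭; shift; drop-mid; ++-comm; ↭-singleton-inv) renaming (++⁺ʳ to ++⁺ʳ-↭)
open import Data.List.Relation.Binary.Sublist.Propositional
  using (_⊆_; []; _∷_; _∷ʳ_; ⊆-refl; ⊆-trans; minimum; from∈; to∈)
open import Data.List.Relation.Binary.Sublist.Propositional.Properties
  using (++⁺; ++⁺ʳ; Any-resp-⊆; take-⊆; drop-⊆; length-mono-≤)
open import Data.List.Relation.Unary.AllPairs using (_∷_)
import Data.List.Relation.Unary.All as All
open import Data.List.Relation.Unary.Any using (here; there)
open import Data.List.Relation.Unary.Unique.Propositional using (Unique)
import Data.List.Relation.Unary.Unique.Propositional.Properties as Unique
open import Data.List.Reverse using (Reverse; []; _∶_∶ʳ_; reverseView)
open import Data.Nat using (ℕ; zero; suc; _+_; _∸_; _≤_; _<_; _≤ᵇ_; _≡ᵇ_; z≤n; s≤s; _≤?_; _≟_)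
open import Data.Nat.Properties
open import Data.Product using (Σ; ∃; ∃₂; _×_; _,_; proj₁; proj₂)
open import Data.Sum using (_⊎_; inj₁; inj₂)
import Data.Sum as Sum
open import Data.Unit using (⊤; tt)
open import Function using (_∘_; id)
open import Relation.Binary.Definitions using (tri<; tri≈; tri>)
open import Relation.Binary.PropositionalEquality
  using (_≡_; _≢_; refl; sym; trans; cong; cong₂; subst; subst₂; module ≡-Reasoning)
open import Relation.Binary.PropositionalEquality.Properties using (setoid)
open import Relation.Nullary using (¬_; yes; no)
open import Relation.Nullary.Decidable using (T?)

open import Data.List.Relation.Binary.Permutation.Setoid.Properties (setoid ℕ) using (Unique-resp-↭)

⊆-++-split : ∀ {A : Set} {ps : List A} xs ys → ps ⊆ xs ++ ys →
             ∃₂ λ p₁ p₂ → ps ≡ p₁ ++ p₂ × p₁ ⊆ xs × p₂ ⊆ ys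
⊆-++-split []       ys τ = [] , _ , refl , [] , τ
⊆-++-split (x ∷ xs) ys (.x ∷ʳ τ) with ⊆-++-split xs ys τ
... | p₁ , p₂ , e , τ₁ , τ₂ = p₁ , p₂ , e , x ∷ʳ τ₁ , τ₂
⊆-++-split (x ∷ xs) ys (refl ∷ τ) with ⊆-++-split xs ys τ
... | p₁ , p₂ , refl , τ₁ , τ₂ = x ∷ p₁ , p₂ , refl , refl ∷ τ₁ , τ₂

⊆-++[]⁻ : ∀ {A : Set} {ps : List A} xs {b} → ps ⊆ xs ++ [ b ] →
          ps ⊆ xs ⊎ ∃ λ p → ps ≡ p ++ [ b ] × p ⊆ xs
⊆-++[]⁻ []       (_ ∷ʳ [])   = inj₁ []
⊆-++[]⁻ []       (refl ∷ []) = inj₂ ([] , refl , [])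
⊆-++[]⁻ (x ∷ xs) (.x ∷ʳ τ)   = Sum.map (x ∷ʳ_) (λ (p , e , σ) → p , e , x ∷ʳ σ) (⊆-++[]⁻ xs τ)
⊆-++[]⁻ (x ∷ xs) (refl ∷ τ) with ⊆-++[]⁻ xs τ
... | inj₁ σ             = inj₁ (refl ∷ σ)
... | inj₂ (p , refl , σ) = inj₂ (x ∷ p , refl , refl ∷ σ)

⊆-insert⁻ : ∀ {A : Set} {ps : List A} xs k ys → ps ⊆ xs ++ k ∷ ys →
            ps ⊆ xs ++ ys ⊎ ∃₂ λ p₁ p₂ → ps ≡ p₁ ++ k ∷ p₂ × p₁ ⊆ xs × p₂ ⊆ ys
⊆-insert⁻ xs k ys τ with ⊆-++-split xs (k ∷ ys) τ
... | p₁ , p₂ , e , τ₁ , _ ∷ʳ τ₂  = inj₁ (subst (_⊆ xs ++ ys) (sym e) (++⁺ τ₁ τ₂))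
... | p₁ , _ , e , τ₁ , refl ∷ τ₂ = inj₂ (p₁ , _ , e , τ₁ , τ₂)

∈-++[]⁻ : ∀ {A : Set} {v b : A} xs → v ∈ xs ++ [ b ] → v ∈ xs ⊎ v ≡ b
∈-++[]⁻ xs p = Sum.map₂ (λ { (here e) → e ; (there ()) }) (∈-++⁻ xs p)

∈-take-drop⁻ : ∀ {A : Set} {y : A} q xs → y ∈ xs → y ∈ take q xs ⊎ y ∈ drop q xs
∈-take-drop⁻ q xs y∈ = ∈-++⁻ (take q xs) (subst (_ ∈_) (sym (take++drop≡id q xs)) y∈)

∈-insert⁺ : ∀ {A : Set} {y : A} xs k ys → y ∈ xs ++ ys → y ∈ xs ++ k ∷ ys
∈-insert⁺ xs k ys y∈ = Sum.[ ∈-++⁺ˡ , ∈-++⁺ʳ xs ∘ there ] (∈-++⁻ xs y∈)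

∈-insert⁻ : ∀ {A : Set} {y : A} xs k ys → y ∈ xs ++ k ∷ ys → y ≡ k ⊎ y ∈ xs ++ ys
∈-insert⁻ xs k ys y∈ with ∈-++⁻ xs y∈
... | inj₁ y∈xs         = inj₂ (∈-++⁺ˡ y∈xs)
... | inj₂ (here y≡k)   = inj₁ y≡k
... | inj₂ (there y∈ys) = inj₂ (∈-++⁺ʳ xs y∈ys)

∈-take-insert : ∀ {A : Set} (xs : List A) k ys s → length xs < s → k ∈ take s (xs ++ k ∷ ys)
∈-take-insert []       k ys (suc s) _         = here refl
∈-take-insert (x ∷ xs) k ys (suc s) (s≤s xs<) = there (∈-take-insert xs k ys s xs<)

∃∈-drop : ∀ {A : Set} i (xs : List A) → i < length xs → ∃ λ y → y ∈ drop i xs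
∃∈-drop zero    (x ∷ xs) _         = x , here refl
∃∈-drop (suc i) (x ∷ xs) (s≤s i<) = ∃∈-drop i xs i<

take-++-≤ : ∀ {A : Set} i (xs ys : List A) → i ≤ length xs → take i (xs ++ ys) ≡ take i xs
take-++-≤ zero    xs       ys _         = refl
take-++-≤ (suc i) (x ∷ xs) ys (s≤s i≤) = cong (x ∷_) (take-++-≤ i xs ys i≤)

drop-++-≤ : ∀ {A : Set} i (xs ys : List A) → i ≤ length xs → drop i (xs ++ ys) ≡ drop i xs ++ ys
drop-++-≤ zero    xs       ys _         = refl
drop-++-≤ (suc i) (x ∷ xs) ys (s≤s i≤) = drop-++-≤ i xs ys i≤

take-length-++ : ∀ {A : Set} (xs ys : List A) → take (length xs) (xs ++ ys) ≡ xs
take-length-++ xs ys = trans (take-++-≤ (length xs) xs ys ≤-refl) (take-all (length xs) xs ≤-refl)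

drop-length-++ : ∀ {A : Set} (xs ys : List A) → drop (length xs) (xs ++ ys) ≡ ys
drop-length-++ xs ys = trans (drop-++-≤ (length xs) xs ys ≤-refl) (cong (_++ ys) (drop-all (length xs) xs ≤-refl))

take-suc-nthOr : ∀ {A : Set} {d : A} i xs → i < length xs → take (suc i) xs ≡ take i xs ++ [ nthOr d i xs ]
take-suc-nthOr zero    (x ∷ xs) _         = refl
take-suc-nthOr (suc i) (x ∷ xs) (s≤s i<) = cong (x ∷_) (take-suc-nthOr i xs i<)

length-++-[] : ∀ {A : Set} (xs : List A) y → length (xs ++ [ y ]) ≡ suc (length xs)
length-++-[] xs y = trans (length-++ xs) (+-comm (length xs) 1)

length-insert : ∀ {A : Set} (xs : List A) y ys → length (xs ++ y ∷ ys) ≡ suc (length (xs ++ ys))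
length-insert []       y ys = refl
length-insert (x ∷ xs) y ys = cong suc (length-insert xs y ys)

nthOr-++ˡ : ∀ {A : Set} {d : A} i xs ys → i < length xs → nthOr d i (xs ++ ys) ≡ nthOr d i xs
nthOr-++ˡ zero    (x ∷ xs) ys _         = refl
nthOr-++ˡ (suc i) (x ∷ xs) ys (s≤s i<) = nthOr-++ˡ i xs ys i<

nthOr-++-length : ∀ {A : Set} {d : A} xs y ys → nthOr d (length xs) (xs ++ y ∷ ys) ≡ y
nthOr-++-length []       y ys = refl
nthOr-++-length (x ∷ xs) y ys = nthOr-++-length xs y ys

nthOr-insert : ∀ {A : Set} {d : A} i xs y ys → length xs ≤ i → nthOr d (suc i) (xs ++ y ∷ ys) ≡ nthOr d i (xs ++ ys)
nthOr-insert i       []       y ys _         = refl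
nthOr-insert (suc i) (x ∷ xs) y ys (s≤s i≥) = nthOr-insert i xs y ys i≥

nthOr-∈ : ∀ {A : Set} {d : A} i xs → i < length xs → nthOr d i xs ∈ xs
nthOr-∈ zero    (x ∷ xs) _         = here refl
nthOr-∈ (suc i) (x ∷ xs) (s≤s i<) = there (nthOr-∈ i xs i<)

insert-injective : ∀ {A : Set} (xs ys xs′ ys′ : List A) k → k ∉ xs → k ∉ xs′ →
                   xs ++ k ∷ ys ≡ xs′ ++ k ∷ ys′ → xs ≡ xs′ × ys ≡ ys′
insert-injective []       ys []         ys′ k _   _    refl = refl , refl
insert-injective []       ys (_ ∷ xs′) ys′ k _   k∉xs′ refl = ⊥-elim (k∉xs′ (here refl))
insert-injective (_ ∷ xs) ys []         ys′ k k∉xs _    refl = ⊥-elim (k∉xs (here refl))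
insert-injective (x ∷ xs) ys (x′ ∷ xs′) ys′ k k∉xs k∉xs′ e with ∷-injective e
... | refl , e′ with insert-injective xs ys xs′ ys′ k (k∉xs ∘ there) (k∉xs′ ∘ there) e′
...   | refl , refl = refl , refl

OccursAt : (ℕ → ℕ → ℕ → Set) → List ℕ → Set
OccursAt R xs = Σ (Fin (length xs)) λ i → Σ (Fin (length xs)) λ j → Σ (Fin (length xs)) λ k →
  i <ᶠ j × j <ᶠ k × R (lookup xs i) (lookup xs j) (lookup xs k)

Avoids₃ : (ℕ → ℕ → ℕ → Set) → List ℕ → Set
Avoids₃ R xs = ∀ {x y z} → x ∷ y ∷ z ∷ [] ⊆ xs → ¬ R x y z

Pattern231 : ℕ → ℕ → ℕ → Set
Pattern231 x y z = z < x × x < y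

Pattern101 : ℕ → ℕ → ℕ → Set
Pattern101 x y z = x ≡ z × y < z

lookup-⊆ : ∀ (xs : List ℕ) (i : Fin (length xs)) → [ lookup xs i ] ⊆ xs
lookup-⊆ (x ∷ xs) fzero    = refl ∷ minimum xs
lookup-⊆ (x ∷ xs) (fsuc i) = x ∷ʳ lookup-⊆ xs i

lookup₂-⊆ : ∀ (xs : List ℕ) {i j : Fin (length xs)} → i <ᶠ j → lookup xs i ∷ lookup xs j ∷ [] ⊆ xs
lookup₂-⊆ (x ∷ xs) {fzero}  {fsuc j} _         = refl ∷ lookup-⊆ xs j
lookup₂-⊆ (x ∷ xs) {fsuc i} {fsuc j} (s≤s i<j) = x ∷ʳ lookup₂-⊆ xs i<j

lookup₃-⊆ : ∀ (xs : List ℕ) {i j k : Fin (length xs)} → i <ᶠ j → j <ᶠ k →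
            lookup xs i ∷ lookup xs j ∷ lookup xs k ∷ [] ⊆ xs
lookup₃-⊆ (x ∷ xs) {fzero}  {fsuc j} {fsuc k} _         (s≤s j<k) = refl ∷ lookup₂-⊆ xs j<k
lookup₃-⊆ (x ∷ xs) {fsuc i} {fsuc j} {fsuc k} (s≤s i<j) (s≤s j<k) = x ∷ʳ lookup₃-⊆ xs i<j j<k

⊆-lookup : ∀ {x : ℕ} {xs} → [ x ] ⊆ xs → Σ (Fin (length xs)) λ i → lookup xs i ≡ x
⊆-lookup (_ ∷ʳ τ)   = let i , e = ⊆-lookup τ in fsuc i , e
⊆-lookup (refl ∷ τ) = fzero , refl

⊆-lookup₂ : ∀ {x y : ℕ} {xs} → x ∷ y ∷ [] ⊆ xs → Σ (Fin (length xs)) λ i → Σ (Fin (length xs)) λ j →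
            i <ᶠ j × lookup xs i ≡ x × lookup xs j ≡ y
⊆-lookup₂ (_ ∷ʳ τ) =
  let i , j , i<j , eᵢ , eⱼ = ⊆-lookup₂ τ in fsuc i , fsuc j , s≤s i<j , eᵢ , eⱼ
⊆-lookup₂ (refl ∷ τ) = let j , eⱼ = ⊆-lookup τ in fzero , fsuc j , s≤s z≤n , refl , eⱼ

⊆-lookup₃ : ∀ {x y z : ℕ} {xs} → x ∷ y ∷ z ∷ [] ⊆ xs →
            Σ (Fin (length xs)) λ i → Σ (Fin (length xs)) λ j → Σ (Fin (length xs)) λ k →
            i <ᶠ j × j <ᶠ k × lookup xs i ≡ x × lookup xs j ≡ y × lookup xs k ≡ z
⊆-lookup₃ (_ ∷ʳ τ) =
  let i , j , k , i<j , j<k , eᵢ , eⱼ , eₖ = ⊆-lookup₃ τ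
  in  fsuc i , fsuc j , fsuc k , s≤s i<j , s≤s j<k , eᵢ , eⱼ , eₖ
⊆-lookup₃ (refl ∷ τ) =
  let j , k , j<k , eⱼ , eₖ = ⊆-lookup₂ τ
  in  fzero , fsuc j , fsuc k , s≤s z≤n , s≤s j<k , refl , eⱼ , eₖ

¬OccursAt⇒Avoids₃ : ∀ R xs → ¬ OccursAt R xs → Avoids₃ R xs
¬OccursAt⇒Avoids₃ R xs ¬occ {z = z} τ r =
  let i , j , k , i<j , j<k , eᵢ , eⱼ , eₖ = ⊆-lookup₃ τ
  in  ¬occ (i , j , k , i<j , j<k ,
            subst (R _ _) (sym eₖ) (subst₂ (λ a b → R a b z) (sym eᵢ) (sym eⱼ) r))

Avoids₃⇒¬OccursAt : ∀ R xs → Avoids₃ R xs → ¬ OccursAt R xs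
Avoids₃⇒¬OccursAt R xs av (i , j , k , i<j , j<k , r) = av (lookup₃-⊆ xs i<j j<k) r

-- 101-avoiding ascent sequences

ascentBit : ℕ → ℕ → ℕ
ascentBit l b = if suc l ≤ᵇ b then 1 else 0

ascentBit-≥ : ∀ {l b} → b ≤ l → ascentBit l b ≡ 0
ascentBit-≥ {l} {b} b≤l with suc l ≤ᵇ b in eq
... | false = refl
... | true  = ⊥-elim (<⇒≱ (≤ᵇ⇒≤ (suc l) b (subst T (sym eq) tt)) b≤l)

ascentBit-< : ∀ {l b} → l < b → ascentBit l b ≡ 1
ascentBit-< {l} {b} l<b with suc l ≤ᵇ b in eq
... | true  = refl
... | false = ⊥-elim (subst T eq (≤⇒≤ᵇ l<b))

lastOf : ℕ → List ℕ → ℕ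
lastOf x []      = x
lastOf x (y ∷ t) = lastOf y t

lastOf-∈ : ∀ x t → lastOf x t ∈ x ∷ t
lastOf-∈ x []      = here refl
lastOf-∈ x (y ∷ t) = there (lastOf-∈ y t)

⊆-lastOf : ∀ {v} x t → v ∈ x ∷ t → v ≢ lastOf x t → v ∷ lastOf x t ∷ [] ⊆ x ∷ t
⊆-lastOf x []      (here refl) v≢last = ⊥-elim (v≢last refl)
⊆-lastOf x (y ∷ t) (here refl) _      = refl ∷ from∈ (lastOf-∈ y t)
⊆-lastOf x (y ∷ t) (there v∈) v≢last  = x ∷ʳ ⊆-lastOf y t v∈ v≢last

asc-++[] : ∀ x t b → asc (x ∷ t ++ [ b ]) ≡ asc (x ∷ t) + ascentBit (lastOf x t) b
asc-++[] x []      b = +-identityʳ (ascentBit x b)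
asc-++[] x (y ∷ t) b = trans (cong (ascentBit x y +_) (asc-++[] y t b)) (sym (+-assoc (ascentBit x y) _ _))

AscentFrom : List ℕ → List ℕ → Set
AscentFrom pre []      = ⊤
AscentFrom pre (x ∷ r) = x ≤ asc pre + 1 × AscentFrom (pre ++ [ x ]) r

ascentBounds⇒AscentFrom : ∀ pre r → (∀ (i : Fin (length r)) → lookup r i ≤ asc (pre ++ take (toℕ i) r) + 1) →
                          AscentFrom pre r
ascentBounds⇒AscentFrom pre []      bounds = tt
ascentBounds⇒AscentFrom pre (x ∷ r) bounds =
  subst (λ p → x ≤ asc p + 1) (++-identityʳ pre) (bounds fzero) ,
  ascentBounds⇒AscentFrom (pre ++ [ x ]) r
    (λ i → subst (λ p → lookup r i ≤ asc p + 1) (sym (++-assoc pre [ x ] _)) (bounds (fsuc i)))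

AscentFrom⇒ascentBounds : ∀ pre r → AscentFrom pre r →
                          ∀ (i : Fin (length r)) → lookup r i ≤ asc (pre ++ take (toℕ i) r) + 1
AscentFrom⇒ascentBounds pre (x ∷ r) (x≤ , _) fzero =
  subst (λ p → x ≤ asc p + 1) (sym (++-identityʳ pre)) x≤
AscentFrom⇒ascentBounds pre (x ∷ r) (_ , rest) (fsuc i) =
  subst (λ p → lookup r i ≤ asc p + 1) (++-assoc pre [ x ] _) (AscentFrom⇒ascentBounds (pre ++ [ x ]) r rest i)

AscentFrom-++[]⁻ : ∀ pre r b → AscentFrom pre (r ++ [ b ]) → AscentFrom pre r × b ≤ asc (pre ++ r) + 1
AscentFrom-++[]⁻ pre []      b (b≤ , _) = tt , subst (λ p → b ≤ asc p + 1) (sym (++-identityʳ pre)) b≤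
AscentFrom-++[]⁻ pre (x ∷ r) b (x≤ , rest) =
  let asc-r , b≤ = AscentFrom-++[]⁻ (pre ++ [ x ]) r b rest
  in  (x≤ , asc-r) , subst (λ p → b ≤ asc p + 1) (++-assoc pre [ x ] r) b≤

AscentFrom-++[]⁺ : ∀ pre r b → AscentFrom pre r → b ≤ asc (pre ++ r) + 1 → AscentFrom pre (r ++ [ b ])
AscentFrom-++[]⁺ pre []      b _           b≤ = subst (λ p → b ≤ asc p + 1) (++-identityʳ pre) b≤ , tt
AscentFrom-++[]⁺ pre (x ∷ r) b (x≤ , rest) b≤ =
  x≤ , AscentFrom-++[]⁺ (pre ++ [ x ]) r b rest (subst (λ p → b ≤ asc p + 1) (sym (++-assoc pre [ x ] r)) b≤)

Blocked : List ℕ → ℕ → Set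
Blocked xs b = ∃ λ y → b ∷ y ∷ [] ⊆ xs × y < b

Allowed : List ℕ → ℕ → Set
Allowed xs b = b ≤ asc xs + 1 × ¬ Blocked xs b

IsCAsc : List ℕ → Set
IsCAsc []      = ⊥
IsCAsc (x ∷ t) = x ≡ 0 × AscentFrom [] (x ∷ t) × Avoids₃ Pattern101 (x ∷ t)

CAsc⇒IsCAsc : ∀ {n} x t → CAsc n (x ∷ t) → IsCAsc (x ∷ t)
CAsc⇒IsCAsc x t (_ , (first , bounds) , av) =
  first fzero refl , ascentBounds⇒AscentFrom [] (x ∷ t) bounds , ¬OccursAt⇒Avoids₃ Pattern101 (x ∷ t) av

IsCAsc⇒CAsc : ∀ {n} x t → length (x ∷ t) ≡ n → IsCAsc (x ∷ t) → CAsc n (x ∷ t)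
IsCAsc⇒CAsc x t len (x≡0 , asc-xt , av) =
  len , (first , AscentFrom⇒ascentBounds [] (x ∷ t) asc-xt) , Avoids₃⇒¬OccursAt Pattern101 (x ∷ t) av
  where
  first : ∀ (i : Fin (length (x ∷ t))) → toℕ i ≡ 0 → lookup (x ∷ t) i ≡ 0
  first fzero    _  = x≡0
  first (fsuc i) ()

Avoids101-++[]⁻ : ∀ xs b → Avoids₃ Pattern101 (xs ++ [ b ]) → Avoids₃ Pattern101 xs × ¬ Blocked xs b
Avoids101-++[]⁻ xs b av = (λ τ → av (++⁺ʳ [ b ] τ)) , λ (y , τ , y<b) → av (++⁺ τ (refl ∷ [])) (refl , y<b)

Avoids101-++[]⁺ : ∀ xs b → Avoids₃ Pattern101 xs → ¬ Blocked xs b → Avoids₃ Pattern101 (xs ++ [ b ])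
Avoids101-++[]⁺ xs b av ¬blocked τ (x≡z , y<z) with ⊆-++[]⁻ xs τ
... | inj₁ σ = av σ (x≡z , y<z)
... | inj₂ (p , e , σ) with ∷ʳ-injective (_ ∷ _ ∷ []) p e
...   | refl , refl = ¬blocked (_ , subst (λ w → w ∷ _ ∷ [] ⊆ xs) x≡z σ , y<z)

IsCAsc-++[]⁻ : ∀ x t b → IsCAsc (x ∷ t ++ [ b ]) → IsCAsc (x ∷ t) × Allowed (x ∷ t) b
IsCAsc-++[]⁻ x t b (x≡0 , asc-xtb , av) =
  let asc-xt , b≤ = AscentFrom-++[]⁻ [] (x ∷ t) b asc-xtb
      av-xt , ¬blocked = Avoids101-++[]⁻ (x ∷ t) b av
  in  (x≡0 , asc-xt , av-xt) , b≤ , ¬blocked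

IsCAsc-++[]⁺ : ∀ x t b → IsCAsc (x ∷ t) → Allowed (x ∷ t) b → IsCAsc (x ∷ t ++ [ b ])
IsCAsc-++[]⁺ x t b (x≡0 , asc-xt , av) (b≤ , ¬blocked) =
  x≡0 , AscentFrom-++[]⁺ [] (x ∷ t) b asc-xt b≤ , Avoids101-++[]⁺ (x ∷ t) b av ¬blocked

ValuesUpToAsc : List ℕ → Set
ValuesUpToAsc xs = (∀ {v} → v ≤ asc xs → v ∈ xs) × (∀ {v} → v ∈ xs → v ≤ asc xs)

ValuesUpToAsc-[0] : ValuesUpToAsc [ 0 ]
ValuesUpToAsc-[0] = (λ { z≤n → here refl }) , λ { (here refl) → z≤n ; (there ()) }

module _ {x : ℕ} {t : List ℕ} {b : ℕ} (values : ValuesUpToAsc (x ∷ t)) (allowed : Allowed (x ∷ t) b) where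

  asc-++-Allowed : (b ≤ asc (x ∷ t) × asc (x ∷ t ++ [ b ]) ≡ asc (x ∷ t)) ⊎
                   (b ≡ asc (x ∷ t) + 1 × asc (x ∷ t ++ [ b ]) ≡ asc (x ∷ t) + 1)
  asc-++-Allowed with b ≤? asc (x ∷ t)
  ... | yes b≤m = inj₁ (b≤m , trans (asc-++[] x t b) (trans (cong (asc (x ∷ t) +_) (ascentBit-≥ b≤last)) (+-identityʳ _)))
    where
    -- b occurs in x ∷ t; were it above the last entry, that occurrence would be blocked
    b≤last : b ≤ lastOf x t
    b≤last = ≮⇒≥ λ last<b →
      proj₂ allowed (lastOf x t , ⊆-lastOf x t (proj₁ values b≤m) (>⇒≢ last<b) , last<b)
  ... | no b≰m = inj₂ (b≡m+1 , trans (asc-++[] x t b) (cong (asc (x ∷ t) +_) (ascentBit-< last<b)))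
    where
    b≡m+1 : b ≡ asc (x ∷ t) + 1
    b≡m+1 = ≤-antisym (proj₁ allowed) (subst (_≤ b) (+-comm 1 _) (≰⇒> b≰m))
    last<b : lastOf x t < b
    last<b = ≤-<-trans (proj₂ values (lastOf-∈ x t)) (≰⇒> b≰m)

  asc≤asc-++-Allowed : asc (x ∷ t) ≤ asc (x ∷ t ++ [ b ])
  asc≤asc-++-Allowed with asc-++-Allowed
  ... | inj₁ (_ , e) = ≤-reflexive (sym e)
  ... | inj₂ (_ , e) = subst (asc (x ∷ t) ≤_) (sym e) (m≤m+n _ 1)

  ValuesUpToAsc-++-Allowed : ValuesUpToAsc (x ∷ t ++ [ b ])
  ValuesUpToAsc-++-Allowed = occurs , bounded
    where
    occurs : ∀ {v} → v ≤ asc (x ∷ t ++ [ b ]) → v ∈ x ∷ t ++ [ b ]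
    occurs {v} v≤ with asc-++-Allowed | v ≤? asc (x ∷ t)
    ... | _                 | yes v≤m = ∈-++⁺ˡ (proj₁ values v≤m)
    ... | inj₁ (_ , e)      | no v≰m  = ⊥-elim (v≰m (subst (v ≤_) e v≤))
    ... | inj₂ (b≡ , e)     | no v≰m  =
      ∈-++⁺ʳ (x ∷ t) (here (trans (≤-antisym (subst (v ≤_) e v≤) (subst (_≤ v) (+-comm 1 _) (≰⇒> v≰m))) (sym b≡)))
    bounded : ∀ {v} → v ∈ x ∷ t ++ [ b ] → v ≤ asc (x ∷ t ++ [ b ])
    bounded v∈ with ∈-++[]⁻ (x ∷ t) v∈ | asc-++-Allowed
    ... | inj₁ v∈xt  | _             = ≤-trans (proj₂ values v∈xt) asc≤asc-++-Allowed
    ... | inj₂ refl  | inj₁ (b≤ , e) = subst (b ≤_) (sym e) b≤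
    ... | inj₂ refl  | inj₂ (b≡ , e) = ≤-reflexive (trans b≡ (sym e))

  Allowed-++-Allowed⁻ : ∀ {c} → Allowed (x ∷ t ++ [ b ]) c →
                        (Allowed (x ∷ t) c × c ≤ b) ⊎ c ≡ asc (x ∷ t ++ [ b ]) + 1
  Allowed-++-Allowed⁻ {c} (c≤ , ¬blocked) with c ≟ asc (x ∷ t ++ [ b ]) + 1
  ... | yes c≡ = inj₂ c≡
  ... | no c≢  = inj₁ ((≤-trans c≤b (proj₁ allowed) , λ (y , τ , y<c) → ¬blocked (y , ++⁺ʳ [ b ] τ , y<c)) , c≤b)
    where
    c≤asc : c ≤ asc (x ∷ t ++ [ b ])
    c≤asc = ≤-pred (subst (c <_) (+-comm _ 1) (≤∧≢⇒< c≤ c≢))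
    -- if c > b then c, which occurs before the new last entry b, would be blocked by it
    c≤b : c ≤ b
    c≤b with c ≤? b | asc-++-Allowed
    ... | yes c≤b′ | _             = c≤b′
    ... | no c≰b   | inj₁ (_ , e)  = ⊥-elim (¬blocked (b , ++⁺ (from∈ (proj₁ values (subst (c ≤_) e c≤asc))) (refl ∷ []) , ≰⇒> c≰b))
    ... | no c≰b   | inj₂ (b≡ , e) = ⊥-elim (c≰b (subst (c ≤_) (trans e (sym b≡)) c≤asc))

  Allowed-++-Allowed⁺ : ∀ {c} → (Allowed (x ∷ t) c × c ≤ b) ⊎ c ≡ asc (x ∷ t ++ [ b ]) + 1 →
                        Allowed (x ∷ t ++ [ b ]) c
  Allowed-++-Allowed⁺ {c} (inj₁ ((c≤ , ¬blocked) , c≤b)) = ≤-trans c≤ (+-monoˡ-≤ 1 asc≤asc-++-Allowed) , ¬blocked′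
    where
    ¬blocked′ : ¬ Blocked (x ∷ t ++ [ b ]) c
    ¬blocked′ (y , τ , y<c) with ⊆-++[]⁻ (x ∷ t) τ
    ... | inj₁ σ = ¬blocked (y , σ , y<c)
    ... | inj₂ (p , e , _) with ∷ʳ-injective (c ∷ []) p e
    ...   | _ , refl = <⇒≱ y<c c≤b
  Allowed-++-Allowed⁺ (inj₂ refl) =
    ≤-refl , λ (y , τ , _) → 1+n≰n (subst (_≤ asc (x ∷ t ++ [ b ])) (+-comm _ 1) (proj₂ ValuesUpToAsc-++-Allowed (to∈ τ)))

boolToℕ : Bool → ℕ
boolToℕ false = 0
boolToℕ true  = 1

countBelow : (ℕ → Bool) → ℕ → ℕ
countBelow f zero    = 0
countBelow f (suc s) = countBelow f s + boolToℕ (f s)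

filterᵇ-upTo-suc : ∀ (f : ℕ → Bool) M → filterᵇ f (upTo (suc M)) ≡ filterᵇ f (upTo M) ++ filterᵇ f [ M ]
filterᵇ-upTo-suc f M = trans (cong (filterᵇ f) (sym (upTo-∷ʳ M))) (filter-++ (T? ∘ f) (upTo M) [ M ])

length-filterᵇ-[] : ∀ (f : ℕ → Bool) M → length (filterᵇ f [ M ]) ≡ boolToℕ (f M)
length-filterᵇ-[] f M with f M
... | true  = refl
... | false = refl

length-filterᵇ-upTo : ∀ (f : ℕ → Bool) M → length (filterᵇ f (upTo M)) ≡ countBelow f M
length-filterᵇ-upTo f zero    = refl
length-filterᵇ-upTo f (suc M) = begin
  length (filterᵇ f (upTo (suc M)))                          ≡⟨ cong length (filterᵇ-upTo-suc f M) ⟩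
  length (filterᵇ f (upTo M) ++ filterᵇ f [ M ])             ≡⟨ length-++ (filterᵇ f (upTo M)) ⟩
  length (filterᵇ f (upTo M)) + length (filterᵇ f [ M ])     ≡⟨ cong₂ _+_ (length-filterᵇ-upTo f M) (length-filterᵇ-[] f M) ⟩
  countBelow f (suc M)                                       ∎
  where open ≡-Reasoning

countBelow-mono : ∀ (f : ℕ → Bool) {s s′} → s ≤ s′ → countBelow f s ≤ countBelow f s′
countBelow-mono f {s′ = zero}   z≤n = ≤-refl
countBelow-mono f {s′ = suc s′} s≤ with m≤n⇒m<n∨m≡n s≤
... | inj₂ refl      = ≤-refl
... | inj₁ (s≤s s≤′) = ≤-trans (countBelow-mono f s≤′) (m≤m+n _ _)

countBelow-< : ∀ (f : ℕ → Bool) {s s′} → f s ≡ true → s < s′ → countBelow f s < countBelow f s′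
countBelow-< f {s} {s′} fs s<s′ = begin-strict
  countBelow f s                   <⟨ m<m+n (countBelow f s) (s≤s z≤n) ⟩
  countBelow f s + 1               ≡⟨ cong (λ v → countBelow f s + boolToℕ v) (sym fs) ⟩
  countBelow f (suc s)             ≤⟨ countBelow-mono f s<s′ ⟩
  countBelow f s′                  ∎
  where open ≤-Reasoning

countBelow-cong : ∀ (f g : ℕ → Bool) s → (∀ u → u < s → f u ≡ g u) → countBelow f s ≡ countBelow g s
countBelow-cong f g zero    _  = refl
countBelow-cong f g (suc s) eq =
  cong₂ _+_ (countBelow-cong f g s (λ u u<s → eq u (m<n⇒m<1+n u<s))) (cong boolToℕ (eq s ≤-refl))

countBelow-insertFalse : ∀ (f g : ℕ → Bool) a →
  (∀ u → u < a → g u ≡ f u) → g a ≡ false → (∀ u → a ≤ u → g (suc u) ≡ f u) →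
  ∀ M → a ≤ M → countBelow g (suc M) ≡ countBelow f M
countBelow-insertFalse f g a below at above M a≤M with m≤n⇒m<n∨m≡n a≤M
... | inj₂ refl = trans (cong₂ _+_ (countBelow-cong g f a below) (cong boolToℕ at)) (+-identityʳ _)
countBelow-insertFalse f g a below at above (suc M) a≤M | inj₁ (s≤s a≤M′) =
  cong₂ _+_ (countBelow-insertFalse f g a below at above M a≤M′) (cong boolToℕ (above M a≤M′))

nthOr-filterᵇ-upTo : ∀ (f : ℕ → Bool) d M s → s < M → f s ≡ true →
                     nthOr d (countBelow f s) (filterᵇ f (upTo M)) ≡ s
nthOr-filterᵇ-upTo f d (suc M) s s<M fs rewrite filterᵇ-upTo-suc f M with m≤n⇒m<n∨m≡n (≤-pred s<M)
... | inj₁ s<M′ =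
  trans (nthOr-++ˡ (countBelow f s) (filterᵇ f (upTo M)) _
          (subst (countBelow f s <_) (sym (length-filterᵇ-upTo f M)) (countBelow-< f fs s<M′)))
        (nthOr-filterᵇ-upTo f d M s s<M′ fs)
... | inj₂ refl rewrite fs | sym (length-filterᵇ-upTo f s) = nthOr-++-length (filterᵇ f (upTo s)) s []

-- Permutations and their cuts

IsPerm-bounds : ∀ {n π x} → IsPerm n π → x ∈ π → 1 ≤ x × x ≤ n
IsPerm-bounds pm x∈ with ∈-map⁻ suc (∈-resp-↭ pm x∈)
... | _ , y∈ , refl = s≤s z≤n , ∈-upTo⁻ y∈

IsPerm-∈ : ∀ {n π x} → IsPerm n π → 1 ≤ x → x ≤ n → x ∈ π
IsPerm-∈ {x = suc _} pm _ x≤n = ∈-resp-↭ (↭-sym pm) (∈-map⁺ suc (∈-upTo⁺ x≤n))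

IsPerm⇒Unique : ∀ {n π} → IsPerm n π → Unique π
IsPerm⇒Unique {n} pm = Unique-resp-↭ (↭⇒↭ₛ (↭-sym pm)) (Unique.map⁺ suc-injective (Unique.upTo⁺ n))

Unique-++⇒≢ : ∀ {A : Set} (xs ys : List A) {x y} → Unique (xs ++ ys) → x ∈ xs → y ∈ ys → x ≢ y
Unique-++⇒≢ (_ ∷ xs) ys (x∉ ∷ _) (here refl) y∈ = All.lookup x∉ (∈-++⁺ʳ xs y∈)
Unique-++⇒≢ (_ ∷ xs) ys (_ ∷ u)  (there x∈)  y∈ = Unique-++⇒≢ xs ys u x∈ y∈

map-suc-upTo-suc : ∀ n → map suc (upTo (suc n)) ≡ map suc (upTo n) ++ [ suc n ]
map-suc-upTo-suc n = trans (cong (map suc) (sym (upTo-∷ʳ n))) (map-++ suc (upTo n) [ n ])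

IsPerm-insert : ∀ {n} A B → IsPerm n (A ++ B) → IsPerm (suc n) (A ++ suc n ∷ B)
IsPerm-insert {n} A B pm = begin
  A ++ suc n ∷ B                ↭⟨ shift (suc n) A B ⟩
  suc n ∷ A ++ B                ↭⟨ ++-comm [ suc n ] (A ++ B) ⟩
  (A ++ B) ++ [ suc n ]         ↭⟨ ++⁺ʳ-↭ [ suc n ] pm ⟩
  map suc (upTo n) ++ [ suc n ] ≡⟨ sym (map-suc-upTo-suc n) ⟩
  map suc (upTo (suc n))        ∎
  where open PermutationReasoning

IsPerm-remove : ∀ {n} A B → IsPerm (suc n) (A ++ suc n ∷ B) → IsPerm n (A ++ B)
IsPerm-remove {n} A B pm =
  subst (A ++ B ↭_) (++-identityʳ _) (drop-mid A (map suc (upTo n)) (subst (A ++ suc n ∷ B ↭_) (map-suc-upTo-suc n) pm))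

AllBelow : ℕ → List ℕ → Set
AllBelow k π = ∀ {x} → x ∈ π → x < k

IsPerm⇒AllBelow : ∀ {n π} → IsPerm n π → AllBelow (suc n) π
IsPerm⇒AllBelow pm x∈ = s≤s (proj₂ (IsPerm-bounds pm x∈))

infix 4 _≪_

_≪_ : List ℕ → List ℕ → Set
xs ≪ ys = ∀ {x y} → x ∈ xs → y ∈ ys → x < y

-- inserting a new maximum at site s keeps a 231-avoiding permutation 231-avoiding exactly when s is a cut
IsCut : List ℕ → ℕ → Set
IsCut π s = s ≤ length π × take s π ≪ drop s π

≪⇒IsCut : ∀ A B → A ≪ B → IsCut (A ++ B) (length A)
≪⇒IsCut A B A≪B =
  length-++-≤ˡ A , λ x∈ y∈ → A≪B (subst (_ ∈_) (take-length-++ A B) x∈) (subst (_ ∈_) (drop-length-++ A B) y∈)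

IsCut⇒≪ : ∀ A B → IsCut (A ++ B) (length A) → A ≪ B
IsCut⇒≪ A B (_ , cut) x∈ y∈ = cut (subst (_ ∈_) (sym (take-length-++ A B)) x∈) (subst (_ ∈_) (sym (drop-length-++ A B)) y∈)

IsCut-end : ∀ π → IsCut π (length π)
IsCut-end π = ≤-refl , λ _ y∈ → ⊥-elim (∉[] (setoid ℕ) (subst (_ ∈_) (drop-all (length π) π ≤-refl) y∈))

IsCut-insert-below : ∀ A B k s → s ≤ length A → AllBelow k (A ++ B) → IsCut (A ++ B) s → IsCut (A ++ k ∷ B) s
IsCut-insert-below A B k s s≤ below (_ , cut) = ≤-trans s≤ (length-++-≤ˡ A) , cut′
  where
  cut′ : take s (A ++ k ∷ B) ≪ drop s (A ++ k ∷ B)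
  cut′ {x} {y} x∈ y∈ rewrite take-++-≤ s A (k ∷ B) s≤ | drop-++-≤ s A (k ∷ B) s≤ with ∈-insert⁻ (drop s A) k B y∈
  ... | inj₁ refl = below (∈-++⁺ˡ (Any-resp-⊆ (take-⊆ s A) x∈))
  ... | inj₂ y∈′  = cut (subst (x ∈_) (sym (take-++-≤ s A B s≤)) x∈) (subst (y ∈_) (sym (drop-++-≤ s A B s≤)) y∈′)

IsCut-remove-below : ∀ A B k s → s ≤ length A → IsCut (A ++ k ∷ B) s → IsCut (A ++ B) s
IsCut-remove-below A B k s s≤ (_ , cut) = ≤-trans s≤ (length-++-≤ˡ A) , cut′
  where
  cut′ : take s (A ++ B) ≪ drop s (A ++ B)
  cut′ {x} {y} x∈ y∈ rewrite take-++-≤ s A B s≤ | drop-++-≤ s A B s≤ =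
    cut (subst (x ∈_) (sym (take-++-≤ s A (k ∷ B) s≤)) x∈)
        (subst (y ∈_) (sym (drop-++-≤ s A (k ∷ B) s≤)) (∈-insert⁺ (drop s A) k B y∈))

IsCut-insert⁻ : ∀ A B k s → AllBelow k (A ++ B) → IsCut (A ++ k ∷ B) s → s ≤ length A ⊎ s ≡ length (A ++ k ∷ B)
IsCut-insert⁻ A B k s below (s≤ , cut) with s ≤? length A | s ≟ length (A ++ k ∷ B)
... | yes s≤A | _     = inj₁ s≤A
... | no _    | yes e = inj₂ e
... | no s≰A  | no s≢ = ⊥-elim (Sum.[ (λ y≡k → <-irrefl (sym y≡k) k<y) , (λ y∈ → <-asym k<y (below y∈)) ]
                                      (∈-insert⁻ A k B (Any-resp-⊆ (drop-⊆ s (A ++ k ∷ B)) y∈drop)))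
  where
  y = proj₁ (∃∈-drop s (A ++ k ∷ B) (≤∧≢⇒< s≤ s≢))
  y∈drop : y ∈ drop s (A ++ k ∷ B)
  y∈drop = proj₂ (∃∈-drop s (A ++ k ∷ B) (≤∧≢⇒< s≤ s≢))
  k<y : k < y
  k<y = cut (∈-take-insert A k B s (≰⇒> s≰A)) y∈drop

IsCut⇒max∉take : ∀ π q N → IsCut π q → q < length π → (∀ {x} → x ∈ π → x ≤ N) → N ∉ take q π
IsCut⇒max∉take π q N (_ , cut) q< bounded N∈ =
  let y , y∈ = ∃∈-drop q π q< in <⇒≱ (cut N∈ y∈) (bounded (Any-resp-⊆ (drop-⊆ q π) y∈))

Avoids231-remove : ∀ A B k → Avoids₃ Pattern231 (A ++ k ∷ B) → Avoids₃ Pattern231 (A ++ B)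
Avoids231-remove A B k av τ = av (⊆-trans τ (++⁺ (⊆-refl {x = A}) (k ∷ʳ ⊆-refl)))

-- k can only play the 3 of a 231 occurrence, and then its 2 in A and its 1 in B contradict A ≪ B
Avoids231-insert : ∀ A B k → Avoids₃ Pattern231 (A ++ B) → A ≪ B → AllBelow k (A ++ B) →
                   Avoids₃ Pattern231 (A ++ k ∷ B)
Avoids231-insert A B k av A≪B below τ (z<x , x<y) with ⊆-insert⁻ A k B τ
... | inj₁ σ = av σ (z<x , x<y)
... | inj₂ ([] , _ , refl , _ , σ)              = <-asym x<y (below (∈-++⁺ʳ A (to∈ σ)))
... | inj₂ (_ ∷ [] , _ , refl , σ₁ , σ₂)        = <-asym z<x (A≪B (to∈ σ₁) (to∈ σ₂))
... | inj₂ (_ ∷ _ ∷ [] , _ , refl , σ₁ , _)     = <-asym z<x (below (∈-++⁺ˡ (to∈ σ₁)))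
... | inj₂ (_ ∷ _ ∷ _ ∷ [] , _ , () , _ , _)
... | inj₂ (_ ∷ _ ∷ _ ∷ _ ∷ _ , _ , () , _ , _)

Avoids231⇒≪ : ∀ {n} A B → IsPerm (suc n) (A ++ suc n ∷ B) → Avoids₃ Pattern231 (A ++ suc n ∷ B) → A ≪ B
Avoids231⇒≪ {n} A B pm av {x} {y} x∈ y∈ with <-cmp x y
... | tri< x<y _ _ = x<y
... | tri≈ _ x≡y _ = ⊥-elim (Unique-++⇒≢ A B (IsPerm⇒Unique (IsPerm-remove A B pm)) x∈ y∈ x≡y)
... | tri> _ _ y<x = ⊥-elim (av (++⁺ (from∈ x∈) (refl ∷ from∈ y∈)) (y<x , IsPerm⇒AllBelow (IsPerm-remove A B pm) (∈-++⁺ˡ x∈)))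

-- Active sites

≡ᵇ-refl : ∀ m → (m ≡ᵇ m) ≡ true
≡ᵇ-refl zero    = refl
≡ᵇ-refl (suc m) = ≡ᵇ-refl m

≢⇒≡ᵇ-false : ∀ {m n} → m ≢ n → (m ≡ᵇ n) ≡ false
≢⇒≡ᵇ-false {m} {n} m≢n with m ≡ᵇ n in eq
... | false = refl
... | true  = ⊥-elim (m≢n (≡ᵇ⇒≡ m n (subst T (sym eq) tt)))

elemᵇ⇒∈ : ∀ y xs → elemᵇ y xs ≡ true → y ∈ xs
elemᵇ⇒∈ y (x ∷ xs) e with y ≡ᵇ x in eq
... | true  = here (≡ᵇ⇒≡ y x (subst T (sym eq) tt))
... | false = there (elemᵇ⇒∈ y xs e)

∈⇒elemᵇ : ∀ {y xs} → y ∈ xs → elemᵇ y xs ≡ true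
∈⇒elemᵇ {y} (here refl) rewrite ≡ᵇ-refl y = refl
∈⇒elemᵇ {y} {x ∷ _} (there y∈) = trans (cong ((y ≡ᵇ x) ∨_) (∈⇒elemᵇ y∈)) (∨-zeroʳ _)

∉⇒elemᵇ-false : ∀ y xs → y ∉ xs → elemᵇ y xs ≡ false
∉⇒elemᵇ-false y xs y∉ with elemᵇ y xs in eq
... | false = refl
... | true  = ⊥-elim (y∉ (elemᵇ⇒∈ y xs eq))

elemᵇ-insert : ∀ y i A k B → length A ≤ i → y ≢ k →
               elemᵇ y (take (suc i) (A ++ k ∷ B)) ≡ elemᵇ y (take i (A ++ B))
elemᵇ-insert y i       []      k B _         y≢k rewrite ≢⇒≡ᵇ-false y≢k = refl
elemᵇ-insert y (suc i) (a ∷ A) k B (s≤s A≤) y≢k = cong ((y ≡ᵇ a) ∨_) (elemᵇ-insert y i A k B A≤ y≢k)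

-- isActive π (suc i) unfolds to activeTest (suc i ≡ᵇ length π) (nthOr 0 i π) (take i π)
activeTest : Bool → ℕ → List ℕ → Bool
activeTest atEnd x left = atEnd ∨ (x ≡ᵇ 1) ∨ elemᵇ (x ∸ 1) left

activeTest-true : ∀ atEnd x left → atEnd ≡ true ⊎ x ≡ 1 ⊎ x ∸ 1 ∈ left → activeTest atEnd x left ≡ true
activeTest-true .true x  left (inj₁ refl)         = refl
activeTest-true atEnd .1 left (inj₂ (inj₁ refl))  = ∨-zeroʳ atEnd
activeTest-true atEnd x  left (inj₂ (inj₂ x-1∈)) rewrite ∈⇒elemᵇ x-1∈ =
  trans (cong (atEnd ∨_) (∨-zeroʳ (x ≡ᵇ 1))) (∨-zeroʳ atEnd)

activeTest-cong : ∀ {a a′ x x′ l l′} → a ≡ a′ → x ≡ x′ → elemᵇ (x′ ∸ 1) l ≡ elemᵇ (x′ ∸ 1) l′ →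
                  activeTest a x l ≡ activeTest a′ x′ l′
activeTest-cong {a} {x = x} refl refl e = cong (λ c → a ∨ (x ≡ᵇ 1) ∨ c) e

isActive-end : ∀ π → isActive π (length π) ≡ true
isActive-end []      = refl
isActive-end (x ∷ π) =
  activeTest-true _ (nthOr 0 (length π) (x ∷ π)) (take (length π) (x ∷ π)) (inj₁ (≡ᵇ-refl (length π)))

IsCut⇒pred∈left : ∀ {n} π i → IsPerm n π → IsCut π (suc i) → nthOr 0 i π ≢ 1 → nthOr 0 i π ∸ 1 ∈ take i π
IsCut⇒pred∈left π i pm (i< , cut) x≢1 = Sum.[ fromLeft , fromRight ] (∈-take-drop⁻ (suc i) π x-1∈π)
  where
  x = nthOr 0 i π
  bounds = IsPerm-bounds pm (nthOr-∈ i π i<)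
  x-1<x : x ∸ 1 < x
  x-1<x = ∸-monoʳ-< {x} {1} {0} ≤-refl (proj₁ bounds)
  x-1∈π : x ∸ 1 ∈ π
  x-1∈π = IsPerm-∈ pm (∸-monoˡ-≤ 1 (≤∧≢⇒< (proj₁ bounds) (x≢1 ∘ sym))) (≤-trans (m∸n≤m x 1) (proj₂ bounds))
  fromLeft : x ∸ 1 ∈ take (suc i) π → x ∸ 1 ∈ take i π
  fromLeft x-1∈ = Sum.[ id , (λ x-1≡x → ⊥-elim (<-irrefl x-1≡x x-1<x)) ]
                      (∈-++[]⁻ (take i π) (subst (x ∸ 1 ∈_) (take-suc-nthOr i π i<) x-1∈))
  fromRight : x ∸ 1 ∈ drop (suc i) π → x ∸ 1 ∈ take i π
  fromRight x-1∈ = ⊥-elim (<-asym x-1<x (cut (subst (x ∈_) (sym (take-suc-nthOr i π i<)) (∈-++⁺ʳ (take i π) (here refl))) x-1∈))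

IsCut⇒isActive : ∀ {n} π s → IsPerm n π → IsCut π s → isActive π s ≡ true
IsCut⇒isActive π zero    _  _   = refl
IsCut⇒isActive π (suc i) pm cut with nthOr 0 i π ≟ 1
... | yes x≡1 = activeTest-true (suc i ≡ᵇ length π) (nthOr 0 i π) (take i π) (inj₂ (inj₁ x≡1))
... | no x≢1  = activeTest-true (suc i ≡ᵇ length π) (nthOr 0 i π) (take i π) (inj₂ (inj₂ (IsCut⇒pred∈left π i pm cut x≢1)))

isActive-insert-below : ∀ A B k s → s ≤ length A → s < length (A ++ B) →
                        isActive (A ++ k ∷ B) s ≡ isActive (A ++ B) s
isActive-insert-below A B k zero    _   _    = refl
isActive-insert-below A B k (suc i) i<A s<AB = activeTest-cong {l = take i (A ++ k ∷ B)} {l′ = take i (A ++ B)}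
  (trans (≢⇒≡ᵇ-false (<⇒≢ (subst (suc i <_) (sym (length-insert A k B)) (m<n⇒m<1+n s<AB))))
         (sym (≢⇒≡ᵇ-false (<⇒≢ s<AB))))
  (trans (nthOr-++ˡ i A (k ∷ B) i<A) (sym (nthOr-++ˡ i A B i<A)))
  (cong (elemᵇ (nthOr 0 i (A ++ B) ∸ 1)) (trans (take-++-≤ i A (k ∷ B) (<⇒≤ i<A)) (sym (take-++-≤ i A B (<⇒≤ i<A)))))

suc-length<length-insert₂ : ∀ (A : List ℕ) k b₀ B → suc (length A) < length (A ++ k ∷ b₀ ∷ B)
suc-length<length-insert₂ []      k b₀ B = s≤s (s≤s z≤n)
suc-length<length-insert₂ (a ∷ A) k b₀ B = s≤s (suc-length<length-insert₂ A k b₀ B)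

isActive-after-insert : ∀ A b₀ B k → 2 ≤ k → k ∸ 1 ∉ A → isActive (A ++ k ∷ b₀ ∷ B) (suc (length A)) ≡ false
isActive-after-insert A b₀ B k 2≤k k-1∉A =
  trans (activeTest-cong {l = take (length A) (A ++ k ∷ b₀ ∷ B)} {l′ = A} (≢⇒≡ᵇ-false (<⇒≢ (suc-length<length-insert₂ A k b₀ B)))
                        (nthOr-++-length A k (b₀ ∷ B)) (cong (elemᵇ (k ∸ 1)) (take-length-++ A (k ∷ b₀ ∷ B))))
        (cong₂ (λ c d → false ∨ c ∨ d) (≢⇒≡ᵇ-false (>⇒≢ 2≤k)) (∉⇒elemᵇ-false (k ∸ 1) A k-1∉A))

AllBelow⇒nthOr< : ∀ {k} π → AllBelow k π → 0 < k → ∀ i → nthOr 0 i π < k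
AllBelow⇒nthOr< []      below 0<k i       = 0<k
AllBelow⇒nthOr< (x ∷ π) below 0<k zero    = below (here refl)
AllBelow⇒nthOr< (x ∷ π) below 0<k (suc i) = AllBelow⇒nthOr< π (below ∘ there) 0<k i

isActive-insert-above : ∀ A B k t → length A < t → AllBelow k (A ++ B) → 0 < k →
                        isActive (A ++ k ∷ B) (suc t) ≡ isActive (A ++ B) t
isActive-insert-above A B k (suc i) (s≤s A≤i) below 0<k =
  activeTest-cong {l = take (suc i) (A ++ k ∷ B)} {l′ = take i (A ++ B)}
  (cong (suc (suc i) ≡ᵇ_) (length-insert A k B))
  (nthOr-insert i A k B A≤i)
  (elemᵇ-insert (nthOr 0 i (A ++ B) ∸ 1) i A k B A≤i (<⇒≢ (≤-<-trans (m∸n≤m _ 1) (AllBelow⇒nthOr< (A ++ B) below 0<k i))))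

countBelow-insert-below : ∀ A B k s → s ≤ length A →
                          countBelow (isActive (A ++ k ∷ B)) s ≡ countBelow (isActive (A ++ B)) s
countBelow-insert-below A B k s s≤A = countBelow-cong (isActive (A ++ k ∷ B)) (isActive (A ++ B)) s λ u u<s →
  isActive-insert-below A B k u (≤-trans (<⇒≤ u<s) s≤A) (<-≤-trans u<s (≤-trans s≤A (length-++-≤ˡ A)))

activeSites-label : ∀ {n} π q → IsPerm n π → IsCut π q → nthOr (length π) (countBelow (isActive π) q) (activeSites π) ≡ q
activeSites-label π q pm cut =
  nthOr-filterᵇ-upTo (isActive π) (length π) (suc (length π)) q (s≤s (proj₁ cut)) (IsCut⇒isActive π q pm cut)

step-at-cut : ∀ {n} k π q → IsPerm n π → IsCut π q → step k (countBelow (isActive π) q) π ≡ take q π ++ k ∷ drop q π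
step-at-cut k π q pm cut = cong (λ s → insertAt s k π) (activeSites-label π q pm cut)

-- countBelow (isActive π) s is the label f_AS gives to site s when s is active, as cuts are;
-- the labels of the cuts of π are to be exactly the entries allowed next in xs
record FASInvariant (xs π : List ℕ) : Set where
  field
    perm         : IsPerm (length xs) π
    avoids       : Avoids₃ Pattern231 π
    activeCount  : countBelow (isActive π) (suc (length π)) ≡ asc xs + 2
    cutWithLabel : ∀ {c} → Allowed xs c → ∃ λ s → IsCut π s × countBelow (isActive π) s ≡ c
    labelAllowed : ∀ {s} → IsCut π s → Allowed xs (countBelow (isActive π) s)

  labelOfEnd : countBelow (isActive π) (length π) ≡ asc xs + 1
  labelOfEnd = +-cancelʳ-≡ 1 _ _ (begin
    countBelow (isActive π) (length π) + 1                                ≡⟨ cong (λ a → countBelow (isActive π) (length π) + boolToℕ a) (isActive-end π) ⟨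
    countBelow (isActive π) (suc (length π))                              ≡⟨ activeCount ⟩
    asc xs + 2                                                            ≡⟨ +-assoc (asc xs) 1 1 ⟨
    asc xs + 1 + 1                                                        ∎)
    where open ≡-Reasoning

module _ {x : ℕ} {t : List ℕ} {b : ℕ} (values : ValuesUpToAsc (x ∷ t)) (allowed : Allowed (x ∷ t) b) where
  private
    xs xs′ : List ℕ
    xs  = x ∷ t
    xs′ = x ∷ t ++ [ b ]
    k : ℕ
    k = suc (length xs)

  FASInvariant-insert : ∀ A B → FASInvariant xs (A ++ B) → IsCut (A ++ B) (length A) →
    countBelow (isActive (A ++ B)) (length A) ≡ b →
    countBelow (isActive (A ++ k ∷ B)) (suc (length (A ++ B))) ≡ asc xs′ + 1 →
    FASInvariant xs′ (A ++ k ∷ B)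
  FASInvariant-insert A B inv cut label top = record
    { perm         = subst (λ n → IsPerm n (A ++ k ∷ B)) (sym (length-++-[] xs b)) (IsPerm-insert A B perm)
    ; avoids       = Avoids231-insert A B k avoids (IsCut⇒≪ A B cut) below
    ; activeCount  = activeCount′
    ; cutWithLabel = cutWithLabel′
    ; labelAllowed = labelAllowed′
    }
    where
    open FASInvariant inv
    f g : ℕ → Bool
    f = isActive (A ++ B)
    g = isActive (A ++ k ∷ B)
    below : AllBelow k (A ++ B)
    below = IsPerm⇒AllBelow perm
    activeCount′ : countBelow g (suc (length (A ++ k ∷ B))) ≡ asc xs′ + 2
    activeCount′ = begin
      countBelow g (suc (length (A ++ k ∷ B)))                  ≡⟨ cong (countBelow g ∘ suc) (length-insert A k B) ⟩
      countBelow g (suc (suc (length (A ++ B))))               ≡⟨ cong₂ _+_ top (cong boolToℕ (trans (cong g (sym (length-insert A k B))) (isActive-end (A ++ k ∷ B)))) ⟩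
      asc xs′ + 1 + 1                                          ≡⟨ +-assoc (asc xs′) 1 1 ⟩
      asc xs′ + 2                                              ∎
      where open ≡-Reasoning
    cut≤A : ∀ {s} → IsCut (A ++ B) s → countBelow f s ≤ b → s ≤ length A
    cut≤A {s} _ s-label≤b = ≮⇒≥ λ A<s →
      <⇒≱ (subst (_< countBelow f s) label (countBelow-< f (IsCut⇒isActive (A ++ B) (length A) perm cut) A<s)) s-label≤b
    cutWithLabel′ : ∀ {c} → Allowed xs′ c → ∃ λ s → IsCut (A ++ k ∷ B) s × countBelow g s ≡ c
    cutWithLabel′ {c} c-allowed with Allowed-++-Allowed⁻ values allowed c-allowed
    ... | inj₂ c≡ = suc (length (A ++ B)) , subst (IsCut (A ++ k ∷ B)) (length-insert A k B) (IsCut-end (A ++ k ∷ B)) ,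
                    trans top (sym c≡)
    ... | inj₁ (c-allowed′ , c≤b) with cutWithLabel c-allowed′
    ...   | s , s-cut , s-label =
      let s≤A = cut≤A s-cut (subst (_≤ b) (sym s-label) c≤b)
      in  s , IsCut-insert-below A B k s s≤A below s-cut , trans (countBelow-insert-below A B k s s≤A) s-label
    labelAllowed′ : ∀ {s} → IsCut (A ++ k ∷ B) s → Allowed xs′ (countBelow g s)
    labelAllowed′ {s} s-cut with IsCut-insert⁻ A B k s below s-cut
    ... | inj₁ s≤A = subst (Allowed xs′) (sym (countBelow-insert-below A B k s s≤A)) (Allowed-++-Allowed⁺ values allowed (inj₁
                       (labelAllowed (IsCut-remove-below A B k s s≤A s-cut) , subst (countBelow f s ≤_) label (countBelow-mono f s≤A))))
    ... | inj₂ s≡end = subst (Allowed xs′) (sym (trans (cong (countBelow g) (trans s≡end (length-insert A k B))) top))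
                         (Allowed-++-Allowed⁺ values allowed (inj₂ refl))

  -- Appending k turns the old last site into a cut, so it stays active, and then b = asc xs + 1.
  -- Inserting k before b₀ adds an inactive site, as k - 1 (the old maximum) lies right of the cut, and b ≤ asc xs.
  labelOfEnd-insert : ∀ A B → FASInvariant xs (A ++ B) → IsCut (A ++ B) (length A) →
    countBelow (isActive (A ++ B)) (length A) ≡ b →
    countBelow (isActive (A ++ k ∷ B)) (suc (length (A ++ B))) ≡ asc xs′ + 1
  labelOfEnd-insert A [] inv cut label = begin
    countBelow g (suc (length (A ++ [])))      ≡⟨ cong (countBelow g ∘ suc ∘ length) (++-identityʳ A) ⟩
    countBelow g (length A) + boolToℕ (g (length A))
                                               ≡⟨ cong₂ _+_ (countBelow-insert-below A [] k (length A) ≤-refl) (cong boolToℕ k-cut-active) ⟩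
    countBelow f (length A) + 1                ≡⟨ cong (_+ 1) (trans label b≡asc′) ⟩
    asc xs′ + 1                                ∎
    where
    open ≡-Reasoning
    open FASInvariant inv
    f g : ℕ → Bool
    f = isActive (A ++ [])
    g = isActive (A ++ [ k ])
    k-cut-active : g (length A) ≡ true
    k-cut-active = IsCut⇒isActive (A ++ [ k ]) (length A) (IsPerm-insert A [] perm)
      (≪⇒IsCut A [ k ] λ { x∈ (here refl) → IsPerm⇒AllBelow perm (∈-++⁺ˡ x∈) })
    b≡asc+1 : b ≡ asc xs + 1
    b≡asc+1 = trans (sym label) (trans (cong (countBelow f) (sym (cong length (++-identityʳ A)))) labelOfEnd)
    b≡asc′ : b ≡ asc xs′
    b≡asc′ with asc-++-Allowed values allowed
    ... | inj₁ (b≤asc , _) = ⊥-elim (1+n≰n (subst (_≤ asc xs) (trans b≡asc+1 (+-comm (asc xs) 1)) b≤asc))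
    ... | inj₂ (_ , e)     = trans b≡asc+1 (sym e)
  labelOfEnd-insert A (b₀ ∷ B) inv cut label = begin
    countBelow g (suc (length (A ++ b₀ ∷ B)))  ≡⟨ countBelow-insertFalse f g (suc (length A)) same-below k-site-inactive same-above _ A<N ⟩
    countBelow f (length (A ++ b₀ ∷ B))        ≡⟨ labelOfEnd ⟩
    asc xs + 1                                 ≡⟨ cong (_+ 1) asc≡asc′ ⟩
    asc xs′ + 1                                ∎
    where
    open ≡-Reasoning
    open FASInvariant inv
    f g : ℕ → Bool
    f = isActive (A ++ b₀ ∷ B)
    g = isActive (A ++ k ∷ b₀ ∷ B)
    A<N : length A < length (A ++ b₀ ∷ B)
    A<N = subst (length A <_) (sym (length-++ A)) (m<m+n (length A) (s≤s z≤n))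
    below : AllBelow k (A ++ b₀ ∷ B)
    below = IsPerm⇒AllBelow perm
    same-below : ∀ u → u < suc (length A) → g u ≡ f u
    same-below u u≤A = isActive-insert-below A (b₀ ∷ B) k u (≤-pred u≤A) (≤-<-trans (≤-pred u≤A) A<N)
    k-site-inactive : g (suc (length A)) ≡ false
    k-site-inactive = isActive-after-insert A b₀ B k (s≤s (s≤s z≤n)) λ N∈A →
      IsCut⇒max∉take (A ++ b₀ ∷ B) (length A) (length xs) cut A<N (proj₂ ∘ IsPerm-bounds perm)
        (subst (length xs ∈_) (sym (take-length-++ A (b₀ ∷ B))) N∈A)
    same-above : ∀ u → suc (length A) ≤ u → g (suc u) ≡ f u
    same-above u A<u = isActive-insert-above A (b₀ ∷ B) k u A<u below (s≤s z≤n)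
    b<asc+1 : b < asc xs + 1
    b<asc+1 = subst₂ _<_ label labelOfEnd (countBelow-< f (IsCut⇒isActive _ (length A) perm cut) A<N)
    asc≡asc′ : asc xs ≡ asc xs′
    asc≡asc′ with asc-++-Allowed values allowed
    ... | inj₁ (_ , e)      = sym e
    ... | inj₂ (b≡asc+1 , _) = ⊥-elim (<-irrefl b≡asc+1 b<asc+1)

  FASInvariant-step : ∀ π → FASInvariant xs π → FASInvariant xs′ (step k b π)
  FASInvariant-step π inv with FASInvariant.cutWithLabel inv allowed
  ... | q , cut , refl = subst (FASInvariant xs′) (sym (step-at-cut k π q (FASInvariant.perm inv) cut))
                           (FASInvariant-insert A B inv′ cut′ label′ (labelOfEnd-insert A B inv′ cut′ label′))
    where
    A B : List ℕ
    A = take q π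
    B = drop q π
    π≡AB : π ≡ A ++ B
    π≡AB = sym (take++drop≡id q π)
    q≡|A| : q ≡ length A
    q≡|A| = sym (trans (length-take q π) (m≤n⇒m⊓n≡m (proj₁ cut)))
    inv′ : FASInvariant xs (A ++ B)
    inv′ = subst (FASInvariant xs) π≡AB inv
    cut′ : IsCut (A ++ B) (length A)
    cut′ = subst₂ IsCut π≡AB q≡|A| cut
    label′ : countBelow (isActive (A ++ B)) (length A) ≡ countBelow (isActive π) q
    label′ = sym (cong₂ (countBelow ∘ isActive) π≡AB q≡|A|)

fAS-go-++[] : ∀ k as b π → fAS-go k (as ++ [ b ]) π ≡ step (k + length as) b (fAS-go k as π)
fAS-go-++[] k []       b π = cong (λ k′ → step k′ b π) (sym (+-identityʳ k))
fAS-go-++[] k (a ∷ as) b π =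
  trans (fAS-go-++[] (suc k) as b (step k a π)) (cong (λ k′ → step k′ b (fAS-go (suc k) as (step k a π))) (sym (+-suc k (length as))))

fAS-++[] : ∀ x t b → fAS (x ∷ t ++ [ b ]) ≡ step (suc (length (x ∷ t))) b (fAS (x ∷ t))
fAS-++[] x t b = fAS-go-++[] 2 t b [ 1 ]

FASInvariant-[] : ∀ x → FASInvariant [ x ] [ 1 ]
FASInvariant-[] x = record
  { perm         = ↭-refl
  ; avoids       = λ τ _ → ≤⇒≯ (length-mono-≤ τ) (s≤s (s≤s z≤n))
  ; activeCount  = refl
  ; cutWithLabel = cutWithLabel
  ; labelAllowed = labelAllowed
  }
  where
  unblocked : ∀ c → ¬ Blocked [ x ] c
  unblocked c (_ , τ , _) = ≤⇒≯ (length-mono-≤ τ) (s≤s (s≤s z≤n))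
  cutWithLabel : ∀ {c} → Allowed [ x ] c → ∃ λ s → IsCut [ 1 ] s × countBelow (isActive [ 1 ]) s ≡ c
  cutWithLabel {0}           _          = 0 , (z≤n , λ ()) , refl
  cutWithLabel {1}           _          = 1 , IsCut-end [ 1 ] , refl
  cutWithLabel {suc (suc _)} (s≤s () , _)
  labelAllowed : ∀ {s} → IsCut [ 1 ] s → Allowed [ x ] (countBelow (isActive [ 1 ]) s)
  labelAllowed {0}           _          = z≤n , unblocked 0
  labelAllowed {1}           _          = ≤-refl , unblocked 1
  labelAllowed {suc (suc _)} (s≤s () , _)

FASInvariant-fAS : ∀ x {t} → Reverse t → IsCAsc (x ∷ t) → ValuesUpToAsc (x ∷ t) × FASInvariant (x ∷ t) (fAS (x ∷ t))
FASInvariant-fAS x [] (refl , _) = ValuesUpToAsc-[0] , FASInvariant-[] 0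
FASInvariant-fAS x (t ∶ rt ∶ʳ b) cx =
  let cx′ , b-allowed = IsCAsc-++[]⁻ x t b cx
      values , inv   = FASInvariant-fAS x rt cx′
  in  ValuesUpToAsc-++-Allowed values b-allowed ,
      subst (FASInvariant (x ∷ t ++ [ b ])) (sym (fAS-++[] x t b)) (FASInvariant-step values b-allowed (fAS (x ∷ t)) inv)

-- the new maximum marks the insertion site, and removing it recovers the permutation
step-injective : ∀ {xs ys σ τ b c} → FASInvariant xs σ → FASInvariant ys τ → length xs ≡ length ys →
                 Allowed xs b → Allowed ys c → step (suc (length xs)) b σ ≡ step (suc (length xs)) c τ →
                 σ ≡ τ × b ≡ c
step-injective {xs} {ys} {σ} {τ} σ-inv τ-inv len b-allowed c-allowed e
  with FASInvariant.cutWithLabel σ-inv b-allowed | FASInvariant.cutWithLabel τ-inv c-allowed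
... | q , q-cut , refl | r , r-cut , refl = σ≡τ , cong₂ (countBelow ∘ isActive) σ≡τ q≡r
  where
  K : ℕ
  K = suc (length xs)
  K∉take : ∀ {n} π s → IsPerm n π → n ≡ length xs → K ∉ take s π
  K∉take π s pm refl K∈ = 1+n≰n (proj₂ (IsPerm-bounds pm (Any-resp-⊆ (take-⊆ s π) K∈)))
  split : take q σ ≡ take r τ × drop q σ ≡ drop r τ
  split = insert-injective (take q σ) (drop q σ) (take r τ) (drop r τ) K
    (K∉take σ q (FASInvariant.perm σ-inv) refl) (K∉take τ r (FASInvariant.perm τ-inv) (sym len))
    (trans (sym (step-at-cut K σ q (FASInvariant.perm σ-inv) q-cut)) (trans e (step-at-cut K τ r (FASInvariant.perm τ-inv) r-cut)))
  σ≡τ : σ ≡ τ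
  σ≡τ = trans (sym (take++drop≡id q σ)) (trans (cong₂ _++_ (proj₁ split) (proj₂ split)) (take++drop≡id r τ))
  q≡r : q ≡ r
  q≡r = trans (sym (trans (length-take q σ) (m≤n⇒m⊓n≡m (proj₁ q-cut))))
              (trans (cong length (proj₁ split)) (trans (length-take r τ) (m≤n⇒m⊓n≡m (proj₁ r-cut))))

fAS-injective : ∀ {x y t u} → Reverse t → Reverse u → length t ≡ length u → IsCAsc (x ∷ t) → IsCAsc (y ∷ u) →
                fAS (x ∷ t) ≡ fAS (y ∷ u) → x ∷ t ≡ y ∷ u
fAS-injective [] [] _ (refl , _) (refl , _) _ = refl
fAS-injective [] (u ∶ _ ∶ʳ c) len _ _ _ = ⊥-elim (0≢1+n (trans len (length-++-[] u c)))
fAS-injective (t ∶ _ ∶ʳ b) [] len _ _ _ = ⊥-elim (0≢1+n (trans (sym len) (length-++-[] t b)))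
fAS-injective {x} {y} (t ∶ rt ∶ʳ b) (u ∶ ru ∶ʳ c) len cx cy e =
  let cx′ , b-allowed = IsCAsc-++[]⁻ x t b cx
      cy′ , c-allowed = IsCAsc-++[]⁻ y u c cy
      len′ = suc-injective (trans (sym (length-++-[] t b)) (trans len (length-++-[] u c)))
      σ≡τ , b≡c = step-injective (proj₂ (FASInvariant-fAS x rt cx′)) (proj₂ (FASInvariant-fAS y ru cy′))
                    (cong suc len′) b-allowed c-allowed
                    (trans (sym (fAS-++[] x t b)) (trans e (trans (fAS-++[] y u c) (cong (λ m → step (suc (suc m)) c _) (sym len′)))))
  in  cong₂ (λ xs z → xs ++ [ z ]) (fAS-injective rt ru len′ cx′ cy′ σ≡τ) b≡c

fAS-surjective : ∀ n π → S231 (suc n) π → ∃₂ λ x t → length t ≡ n × IsCAsc (x ∷ t) × fAS (x ∷ t) ≡ π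
fAS-surjective zero π (pm , _) =
  0 , [] , refl , (refl , (z≤n , tt) , λ τ _ → ≤⇒≯ (length-mono-≤ τ) (s≤s (s≤s z≤n))) , sym (↭-singleton-inv pm)
fAS-surjective (suc n) π (pm , av) with ∈-∃++ (IsPerm-∈ pm (s≤s z≤n) ≤-refl)
... | A , B , refl with fAS-surjective n (A ++ B)
                         (IsPerm-remove A B pm , Avoids₃⇒¬OccursAt Pattern231 _ (Avoids231-remove A B _ av₃))
  where
  av₃ = ¬OccursAt⇒Avoids₃ Pattern231 _ av
...   | x , t , refl , cx , fAS≡AB = x , t ++ [ b ] , length-++-[] t b , IsCAsc-++[]⁺ x t b cx b-allowed , fAS≡
  where
  K : ℕ
  K = suc (length (x ∷ t))
  inv : FASInvariant (x ∷ t) (A ++ B)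
  inv = subst (FASInvariant (x ∷ t)) fAS≡AB (proj₂ (FASInvariant-fAS x (reverseView t) cx))
  cut : IsCut (A ++ B) (length A)
  cut = ≪⇒IsCut A B (Avoids231⇒≪ A B pm (¬OccursAt⇒Avoids₃ Pattern231 _ av))
  b : ℕ
  b = countBelow (isActive (A ++ B)) (length A)
  b-allowed : Allowed (x ∷ t) b
  b-allowed = FASInvariant.labelAllowed inv cut
  fAS≡ : fAS (x ∷ t ++ [ b ]) ≡ A ++ K ∷ B
  fAS≡ = begin
    fAS (x ∷ t ++ [ b ])                              ≡⟨ fAS-++[] x t b ⟩
    step K b (fAS (x ∷ t))                            ≡⟨ cong (step K b) fAS≡AB ⟩
    step K b (A ++ B)                                 ≡⟨ step-at-cut K (A ++ B) (length A) (FASInvariant.perm inv) cut ⟩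
    take (length A) (A ++ B) ++ K ∷ drop (length A) (A ++ B) ≡⟨ cong₂ (λ L R → L ++ K ∷ R) (take-length-++ A B) (drop-length-++ A B) ⟩
    A ++ K ∷ B                                        ∎
    where open ≡-Reasoning

fAS-CAsc⇒S231 : ∀ {n} x t → CAsc n (x ∷ t) → S231 n (fAS (x ∷ t))
fAS-CAsc⇒S231 x t cx =
  let inv = proj₂ (FASInvariant-fAS x (reverseView t) (CAsc⇒IsCAsc x t cx))
  in  subst (λ n → IsPerm n (fAS (x ∷ t))) (proj₁ cx) (FASInvariant.perm inv) ,
      Avoids₃⇒¬OccursAt Pattern231 _ (FASInvariant.avoids inv)

proposition5p8 : (n : ℕ) → 1 ≤ n →
    ((xs : List ℕ) → CAsc n xs → S231 n (fAS xs)) ×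
    ((xs ys : List ℕ) → CAsc n xs → CAsc n ys → fAS xs ≡ fAS ys → xs ≡ ys) ×
    ((π : List ℕ) → S231 n π → Σ (List ℕ) (λ xs → CAsc n xs × fAS xs ≡ π))
proposition5p8 (suc n) _ = into , injective , surjective
  where
  into : (xs : List ℕ) → CAsc (suc n) xs → S231 (suc n) (fAS xs)
  into (x ∷ t) = fAS-CAsc⇒S231 x t
  injective : (xs ys : List ℕ) → CAsc (suc n) xs → CAsc (suc n) ys → fAS xs ≡ fAS ys → xs ≡ ys
  injective (x ∷ t) (y ∷ u) cx cy =
    fAS-injective (reverseView t) (reverseView u) (suc-injective (trans (proj₁ cx) (sym (proj₁ cy))))
                  (CAsc⇒IsCAsc x t cx) (CAsc⇒IsCAsc y u cy)
  surjective : (π : List ℕ) → S231 (suc n) π → Σ (List ℕ) (λ xs → CAsc (suc n) xs × fAS xs ≡ π)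
  surjective π s =
    let x , t , len , cx , fAS≡π = fAS-surjective n π s
    in  x ∷ t , IsCAsc⇒CAsc x t (cong suc len) cx , fAS≡π
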